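{- Let $\alpha\in\mathbb{R}^3$ be a rational vector. Then for every positive integer $m$ that is a sum of three squares, $$\sum_{\substack{(\mu,\mu')\in\mathcal{E}^2\\ \langle\mu-\mu',\alpha\rangle\neq0}}\frac{1}{\langle\mu-\mu',\alpha\rangle^2}\ll_\alpha N\cdot\kappa(\sqrt m).$$
   Context: $\mathcal{E}=\mathcal{E}(m)=\{\mu\in\mathbb{Z}^3:|\mu|^2=m\}$ and $N=\#\mathcal{E}$. A nonzero vector $\alpha$ with (say) $\alpha_1\ne0$ is rational if $\alpha_2/\alpha_1\in\mathbb{Q}$ and $\alpha_3/\alpha_1\in\mathbb{Q}$. For $R>0$, $\kappa(R)$ is the maximal number of points of $\mathbb{Z}^3$ in the intersection of the sphere $\{x\in\mathbb{R}^3:|x|=R\}$ with a plane, maximised over all planes. $\ll_\alpha$ means the implied constant depends only on $\alpha$.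
   Formalization: The vector α has rational coordinates, lying in ℚ³, rather than being a real vector in ℝ³ whose coordinate ratios are rational. -}

module Defs where

open import Data.Nat as ℕ using (ℕ)
open import Data.Integer as ℤ using (ℤ; +_)
import Data.Integer.Properties as ℤP
open import Data.Rational as ℚ using (ℚ; 0ℚ; 1/_; ≢-nonZero)
import Data.Rational.Properties as ℚP
open import Data.List using (List; []; _∷_; map; filter; length; upTo; concatMap; sum)
open import Data.Product using (_×_; _,_; ∃-syntax)
open import Relation.Nullary using (¬_; yes; no)
open import Relation.Binary.PropositionalEquality using (_≡_; _≢_)
open import Data.Bool using (Bool)

ℤ³ : Set
ℤ³ = ℤ × ℤ × ℤ

ℚ³ : Set
ℚ³ = ℚ × ℚ × ℚ

normSq : ℤ³ → ℤ
normSq (x , y , z) = x ℤ.* x ℤ.+ y ℤ.* y ℤ.+ z ℤ.* z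

range : ℕ → List ℤ
range m = map (λ i → + i ℤ.- + m) (upTo (2 ℕ.* m ℕ.+ 1))

-- all of the box [-m,m]³ (which contains every μ with |μ|² = m)
box : ℕ → List ℤ³
box m = concatMap (λ x → concatMap (λ y → map (λ z → (x , y , z)) (range m)) (range m)) (range m)

-- 𝓔(m) = { μ ∈ ℤ³ : |μ|² = m }, as a duplicate-free list
𝓔 : ℕ → List ℤ³
𝓔 m = filter (λ μ → normSq μ ℤP.≟ + m) (box m)

N : ℕ → ℕ
N m = length (𝓔 m)

SumOfThreeSquares : ℕ → Set
SumOfThreeSquares m = ∃[ x ] ∃[ y ] ∃[ z ] (x ℤ.* x ℤ.+ y ℤ.* y ℤ.+ z ℤ.* z ≡ + m)

toℚ : ℤ → ℚ
toℚ a = a ℚ./ 1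

inner : ℤ³ → ℤ³ → ℚ³ → ℚ
inner (a₁ , a₂ , a₃) (b₁ , b₂ , b₃) (c₁ , c₂ , c₃) =
  toℚ (a₁ ℤ.- b₁) ℚ.* c₁ ℚ.+ toℚ (a₂ ℤ.- b₂) ℚ.* c₂ ℚ.+ toℚ (a₃ ℤ.- b₃) ℚ.* c₃

-- summand: 1/t² if t ≠ 0, and 0 if t = 0 (so the sum is over pairs with t ≠ 0)
invSq : ℚ → ℚ
invSq t with t ℚP.≟ 0ℚ
... | yes _ = 0ℚ
... | no t≢0 = (1/_ t {{≢-nonZero t≢0}}) ℚ.* (1/_ t {{≢-nonZero t≢0}})

sumℚ : List ℚ → ℚ
sumℚ [] = 0ℚ
sumℚ (q ∷ qs) = q ℚ.+ sumℚ qs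

S : ℚ³ → ℕ → ℚ
S α m = sumℚ (concatMap (λ μ → map (λ μ' → invSq (inner μ μ' α)) (𝓔 m)) (𝓔 m))

dotℤ : ℤ³ → ℤ³ → ℤ
dotℤ (a₁ , a₂ , a₃) (b₁ , b₂ , b₃) = a₁ ℤ.* b₁ ℤ.+ a₂ ℤ.* b₂ ℤ.+ a₃ ℤ.* b₃

zero³ : ℤ³
zero³ = (+ 0 , + 0 , + 0)

onPlane : ℕ → ℤ³ → ℤ → ℕ
onPlane m n d = length (filter (λ μ → dotℤ n μ ℤP.≟ d) (𝓔 m))

-- IsKappa m k : k = κ(√m), the maximum over planes of the number of lattice
-- points on the sphere of radius √m lying in the plane.
IsKappa : ℕ → ℕ → Set
IsKappa m k =
  (∃[ n ] ∃[ d ] (n ≢ zero³ × onPlane m n d ≡ k)) ×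
  (∀ (n : ℤ³) (d : ℤ) → n ≢ zero³ → onPlane m n d ℕ.≤ k)

{-# OPTIONS --safe #-}
-- Let T be the product of the denominators of α, so that a = Tα is a nonzero integer vector
-- and T⟨μ − μ′, α⟩ = ⟨a, μ⟩ − ⟨a, μ′⟩. For fixed μ, the μ′ ∈ 𝓔 with ⟨a, μ⟩ − ⟨a, μ′⟩ = v lie
-- on the plane ⟨a, x⟩ = ⟨a, μ⟩ − v, so there are at most κ of them, and at most 2κ with
-- |⟨a, μ − μ′⟩| = j. Abel summation over the levels j, using 1/(j+1)² ≤ 1/j − 1/(j+1), bounds
-- the sum over μ′ by T² · 2κ · (1 + 1) = 4T²κ; summing over the N choices of μ gives C = 4T².
module Submission where

open import Algebra.Bundles using (CommutativeRing)
open import Data.Empty using (⊥-elim)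
open import Data.Integer as ℤ using (ℤ; +_; -[1+_]; +[1+_])
import Data.Integer.Properties as ℤP
import Data.Integer.Tactic.RingSolver as ℤ-Solver
open import Data.List using (List; []; _∷_; _++_; map; filter; length; concatMap)
open import Data.List.Extrema.Nat using (max; xs≤max)
open import Data.List.Properties using (map-cong; map-cong-local; filter-≐)
open import Data.List.Relation.Unary.All as All using (All)
open import Data.List.Relation.Unary.All.Properties using (map⁻)
open import Data.Nat as ℕ using (ℕ; zero; suc; z≤n; s≤s)
import Data.Nat.Properties as ℕP
import Data.Nat.Tactic.RingSolver as ℕ-Solver
open import Data.Product using (_,_; proj₁; proj₂; ∃-syntax)
open import Data.Rational as ℚ
  using (ℚ; 0ℚ; 1ℚ; ↥_; ↧_; ↧ₙ_; mkℚ; _+_; _*_; _≤_; NonNegative; toℚᵘ; fromℚᵘ)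
import Data.Rational.Properties as ℚP
open import Data.Rational.Unnormalised as ℚᵘ using (mkℚᵘ; *≡*; *≤*)
import Data.Rational.Unnormalised.Properties as ℚᵘP
open import Data.Sum using (_⊎_; inj₁; inj₂; [_,_]′)
open import Function using (_∘_; id)
open import Level using (0ℓ)
open import Relation.Binary.PropositionalEquality
open import Relation.Nullary using (Dec; yes; no)
open import Relation.Unary using (Pred; Decidable; _⊆_; _∪_)

import Algebra.Properties.CommutativeSemigroup ℕP.*-commutativeSemigroup as ℕ*
import Algebra.Properties.CommutativeSemigroup
  (CommutativeRing.*-commutativeSemigroup ℚP.+-*-commutativeRing) as ℚ*
import Algebra.Properties.CommutativeSemigroup
  (CommutativeRing.+-commutativeSemigroup ℚP.+-*-commutativeRing) as ℚ+

open import Defs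

module _ where
  open ℚᵘP.≃-Reasoning

  fromℚᵘ-homo-+ : ∀ p q → fromℚᵘ (p ℚᵘ.+ q) ≡ fromℚᵘ p + fromℚᵘ q
  fromℚᵘ-homo-+ p q = ℚP.toℚᵘ-injective (begin
    toℚᵘ (fromℚᵘ (p ℚᵘ.+ q))                ≈⟨ ℚP.toℚᵘ-fromℚᵘ (p ℚᵘ.+ q) ⟩
    p ℚᵘ.+ q                                 ≈⟨ ℚᵘP.+-cong (ℚP.toℚᵘ-fromℚᵘ p) (ℚP.toℚᵘ-fromℚᵘ q) ⟨
    toℚᵘ (fromℚᵘ p) ℚᵘ.+ toℚᵘ (fromℚᵘ q)    ≈⟨ ℚP.toℚᵘ-homo-+ (fromℚᵘ p) (fromℚᵘ q) ⟨
    toℚᵘ (fromℚᵘ p + fromℚᵘ q)              ∎)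

  fromℚᵘ-homo-* : ∀ p q → fromℚᵘ (p ℚᵘ.* q) ≡ fromℚᵘ p * fromℚᵘ q
  fromℚᵘ-homo-* p q = ℚP.toℚᵘ-injective (begin
    toℚᵘ (fromℚᵘ (p ℚᵘ.* q))                ≈⟨ ℚP.toℚᵘ-fromℚᵘ (p ℚᵘ.* q) ⟩
    p ℚᵘ.* q                                 ≈⟨ ℚᵘP.*-cong (ℚP.toℚᵘ-fromℚᵘ p) (ℚP.toℚᵘ-fromℚᵘ q) ⟨
    toℚᵘ (fromℚᵘ p) ℚᵘ.* toℚᵘ (fromℚᵘ q)    ≈⟨ ℚP.toℚᵘ-homo-* (fromℚᵘ p) (fromℚᵘ q) ⟨
    toℚᵘ (fromℚᵘ p * fromℚᵘ q)              ∎)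

fromℚᵘ-*-≃ : ∀ p q r → p ℚᵘ.* q ℚᵘ.≃ r → fromℚᵘ p * fromℚᵘ q ≡ fromℚᵘ r
fromℚᵘ-*-≃ p q r pq≃r = trans (sym (fromℚᵘ-homo-* p q)) (ℚP.fromℚᵘ-cong pq≃r)

-- toℚ a is definitionally fromℚᵘ (mkℚᵘ a 0), so facts about toℚ are checked in ℚᵘ.
toℚ-+ : ∀ a b → toℚ (a ℤ.+ b) ≡ toℚ a + toℚ b
toℚ-+ a b = trans (ℚP.fromℚᵘ-cong {mkℚᵘ (a ℤ.+ b) 0} {mkℚᵘ a 0 ℚᵘ.+ mkℚᵘ b 0} (*≡* cross-multiplied))
                  (fromℚᵘ-homo-+ (mkℚᵘ a 0) (mkℚᵘ b 0))
  where
  cross-multiplied : (a ℤ.+ b) ℤ.* + 1 ≡ (a ℤ.* + 1 ℤ.+ b ℤ.* + 1) ℤ.* + 1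
  cross-multiplied = ℤ-Solver.solve (a ∷ b ∷ [])

toℚ-* : ∀ a b → toℚ (a ℤ.* b) ≡ toℚ a * toℚ b
toℚ-* a b = fromℚᵘ-homo-* (mkℚᵘ a 0) (mkℚᵘ b 0)

toℚ-injective : ∀ {a b} → toℚ a ≡ toℚ b → a ≡ b
toℚ-injective {a} {b} eq with ℚP.fromℚᵘ-injective {mkℚᵘ a 0} {mkℚᵘ b 0} eq
... | *≡* a*1≡b*1 = ℤP.*-cancelʳ-≡ a b (+ 1) a*1≡b*1

toℚ-mono-≤ : ∀ {a b} → a ℤ.≤ b → toℚ a ≤ toℚ b
toℚ-mono-≤ {a} {b} a≤b = ℚP.toℚᵘ-cancel-≤
  (ℚᵘP.≤-respʳ-≃ (ℚᵘP.≃-sym (ℚP.toℚᵘ-fromℚᵘ (mkℚᵘ b 0)))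
  (ℚᵘP.≤-respˡ-≃ (ℚᵘP.≃-sym (ℚP.toℚᵘ-fromℚᵘ (mkℚᵘ a 0)))
  (*≤* (ℤP.*-monoʳ-≤-nonNeg (+ 1) a≤b))))

toℚ-ℕ-+ : ∀ m n → toℚ (+ (m ℕ.+ n)) ≡ toℚ (+ m) + toℚ (+ n)
toℚ-ℕ-+ m n = trans (cong toℚ (ℤP.pos-+ m n)) (toℚ-+ (+ m) (+ n))

toℚ-ℕ-* : ∀ m n → toℚ (+ (m ℕ.* n)) ≡ toℚ (+ m) * toℚ (+ n)
toℚ-ℕ-* m n = trans (cong toℚ (ℤP.pos-* m n)) (toℚ-* (+ m) (+ n))

toℚ-nonNeg : ∀ n → NonNegative (toℚ (+ n))
toℚ-nonNeg n = ℚP.normalize-nonNeg n 1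

toℚ-suc-* : ∀ n q → toℚ (+ suc n) * q ≡ q + toℚ (+ n) * q
toℚ-suc-* n q = begin
  toℚ (+ suc n) * q            ≡⟨ cong (_* q) (toℚ-ℕ-+ 1 n) ⟩
  (1ℚ + toℚ (+ n)) * q         ≡⟨ ℚP.*-distribʳ-+ q 1ℚ (toℚ (+ n)) ⟩
  1ℚ * q + toℚ (+ n) * q       ≡⟨ cong (_+ toℚ (+ n) * q) (ℚP.*-identityˡ q) ⟩
  q + toℚ (+ n) * q            ∎
  where open ≡-Reasoning

p*↧p≡↥p : ∀ p → p * toℚ (↧ p) ≡ toℚ (↥ p)
p*↧p≡↥p p@(mkℚ n d-1 _) = trans (cong (_* toℚ (↧ p)) (sym (ℚP.fromℚᵘ-toℚᵘ p)))
  (fromℚᵘ-*-≃ (mkℚᵘ n d-1) (mkℚᵘ (↧ p) 0) (mkℚᵘ n 0) (*≡* cross-multiplied))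
  where
  cross-multiplied : (n ℤ.* + suc d-1) ℤ.* + 1 ≡ n ℤ.* + (suc d-1 ℕ.* 1)
  cross-multiplied = trans (ℤP.*-identityʳ _) (cong (λ d → n ℤ.* + d) (sym (ℕP.*-identityʳ (suc d-1))))

1/suc : ℕ → ℚ
1/suc n = + 1 ℚ./ suc n

1/suc-nonNeg : ∀ n → NonNegative (1/suc n)
1/suc-nonNeg n = ℚP.normalize-nonNeg 1 (suc n)

1/suc-inverse : ∀ n → 1/suc n * toℚ (+ suc n) ≡ 1ℚ
1/suc-inverse n = fromℚᵘ-*-≃ (mkℚᵘ (+ 1) n) (mkℚᵘ (+ suc n) 0) (mkℚᵘ (+ 1) 0) (*≡* cross-multiplied)
  where
  cross-multiplied : (+ 1 ℤ.* + suc n) ℤ.* + 1 ≡ + 1 ℤ.* + (suc n ℕ.* 1)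
  cross-multiplied = trans (ℤP.*-identityʳ _) (cong (λ d → + 1 ℤ.* + d) (sym (ℕP.*-identityʳ (suc n))))

inverse-unique : ∀ {x y z} → x * z ≡ 1ℚ → y * z ≡ 1ℚ → x ≡ y
inverse-unique {x} {y} {z} xz≡1 yz≡1 = begin
  x              ≡⟨ ℚP.*-identityʳ x ⟨
  x * 1ℚ         ≡⟨ cong (x *_) yz≡1 ⟨
  x * (y * z)    ≡⟨ ℚ*.x∙yz≈y∙xz x y z ⟩
  y * (x * z)    ≡⟨ cong (y *_) xz≡1 ⟩
  y * 1ℚ         ≡⟨ ℚP.*-identityʳ y ⟩
  y              ∎
  where open ≡-Reasoning

p*q≡0⇒p≡0∨q≡0 : ∀ p q → p * q ≡ 0ℚ → p ≡ 0ℚ ⊎ q ≡ 0ℚ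
p*q≡0⇒p≡0∨q≡0 p q pq≡0 with q ℚP.≟ 0ℚ
... | yes q≡0 = inj₂ q≡0
... | no  q≢0 = inj₁ (begin
  p                    ≡⟨ ℚP.*-identityʳ p ⟨
  p * 1ℚ               ≡⟨ cong (p *_) (ℚP.*-inverseʳ q) ⟨
  p * (q * ℚ.1/ q)     ≡⟨ ℚP.*-assoc p q (ℚ.1/ q) ⟨
  (p * q) * ℚ.1/ q     ≡⟨ cong (_* ℚ.1/ q) pq≡0 ⟩
  0ℚ * ℚ.1/ q          ≡⟨ ℚP.*-zeroˡ (ℚ.1/ q) ⟩
  0ℚ                   ∎)
  where
  open ≡-Reasoning
  instance _ = ℚ.≢-nonZero q≢0

p≤q+p : ∀ p q → .{{NonNegative q}} → p ≤ q + p
p≤q+p p q = begin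
  p         ≡⟨ ℚP.+-identityˡ p ⟨
  0ℚ + p    ≤⟨ ℚP.+-monoˡ-≤ p (ℚP.nonNegative⁻¹ q) ⟩
  q + p     ∎
  where open ℚP.≤-Reasoning

invSq-inverse : ∀ x → x ≢ 0ℚ → invSq x * (x * x) ≡ 1ℚ
invSq-inverse x x≢0 with x ℚP.≟ 0ℚ
... | yes x≡0  = ⊥-elim (x≢0 x≡0)
... | no  x≢0′ = begin
  (y * y) * (x * x)    ≡⟨ ℚ*.interchange y y x x ⟩
  (y * x) * (y * x)    ≡⟨ cong (λ z → z * z) (ℚP.*-inverseˡ x) ⟩
  1ℚ                   ∎
  where
  open ≡-Reasoning
  instance _ = ℚ.≢-nonZero x≢0′
  y = ℚ.1/ x

invSq-unique : ∀ x {w} → w * (x * x) ≡ 1ℚ → invSq x ≡ w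
invSq-unique x {w} w·x²≡1 = inverse-unique (invSq-inverse x x≢0) w·x²≡1
  where
  x≢0 : x ≢ 0ℚ
  x≢0 refl = ℚP.1≢0 (trans (sym w·x²≡1) (ℚP.*-zeroʳ w))

invSq-scale : ∀ x {t} → t ≢ 0ℚ → invSq x ≡ (t * t) * invSq (x * t)
invSq-scale x {t} t≢0 = by-cases (x ℚP.≟ 0ℚ)
  where
  open ≡-Reasoning
  v = invSq (x * t)
  by-cases : Dec (x ≡ 0ℚ) → invSq x ≡ (t * t) * v
  by-cases (yes refl) rewrite ℚP.*-zeroˡ t = sym (ℚP.*-zeroʳ (t * t))
  by-cases (no  x≢0)  = invSq-unique x (begin
    ((t * t) * v) * (x * x)    ≡⟨ ℚ*.xy∙z≈y∙xz (t * t) v (x * x) ⟩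
    v * ((t * t) * (x * x))    ≡⟨ cong (v *_) (trans (ℚP.*-comm (t * t) (x * x)) (ℚ*.interchange x x t t)) ⟩
    v * ((x * t) * (x * t))    ≡⟨ invSq-inverse (x * t) xt≢0 ⟩
    1ℚ                         ∎)
    where
    xt≢0 : x * t ≢ 0ℚ
    xt≢0 xt≡0 = [ x≢0 , t≢0 ]′ (p*q≡0⇒p≡0∨q≡0 x t xt≡0)

invSqℕ : ℕ → ℚ
invSqℕ zero    = 0ℚ
invSqℕ (suc n) = 1/suc n * 1/suc n

invSqℕ-nonNeg : ∀ n → NonNegative (invSqℕ n)
invSqℕ-nonNeg zero    = _
invSqℕ-nonNeg (suc n) = ℚP.nonNeg*nonNeg⇒nonNeg (1/suc n) {{1/suc-nonNeg n}} (1/suc n) {{1/suc-nonNeg n}}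

invSqℕ-inverse : ∀ n → invSqℕ (suc n) * (toℚ (+ suc n) * toℚ (+ suc n)) ≡ 1ℚ
invSqℕ-inverse n = begin
  (v * v) * (a * a)    ≡⟨ ℚ*.interchange v v a a ⟩
  (v * a) * (v * a)    ≡⟨ cong (λ z → z * z) (1/suc-inverse n) ⟩
  1ℚ                   ∎
  where
  open ≡-Reasoning
  v = 1/suc n
  a = toℚ (+ suc n)

invSq-toℚ : ∀ t → invSq (toℚ t) ≡ invSqℕ ℤ.∣ t ∣
invSq-toℚ (+ zero) = refl
invSq-toℚ +[1+ n ] = invSq-unique (toℚ +[1+ n ]) (invSqℕ-inverse n)
invSq-toℚ -[1+ n ] =
  invSq-unique (toℚ -[1+ n ]) (trans (cong (invSqℕ (suc n) *_) same-square) (invSqℕ-inverse n))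
  where
  same-square : toℚ -[1+ n ] * toℚ -[1+ n ] ≡ toℚ +[1+ n ] * toℚ +[1+ n ]
  same-square = trans (sym (toℚ-* -[1+ n ] -[1+ n ])) (toℚ-* +[1+ n ] +[1+ n ])

-- For u = 1/a and v = 1/(a+1) this says 1/a − 1/(a+1) = 1/(a(a+1)).
reciprocal-difference : ∀ {u v a} → u * a ≡ 1ℚ → v * (1ℚ + a) ≡ 1ℚ → u ≡ u * v + v
reciprocal-difference {u} {v} {a} ua≡1 v[1+a]≡1 = begin
  u                                ≡⟨ ℚP.*-identityʳ u ⟨
  u * 1ℚ                           ≡⟨ cong (u *_) v[1+a]≡1 ⟨
  u * (v * (1ℚ + a))               ≡⟨ cong (u *_) (ℚP.*-distribˡ-+ v 1ℚ a) ⟩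
  u * (v * 1ℚ + v * a)             ≡⟨ ℚP.*-distribˡ-+ u (v * 1ℚ) (v * a) ⟩
  u * (v * 1ℚ) + u * (v * a)       ≡⟨ cong₂ _+_ (cong (u *_) (ℚP.*-identityʳ v)) (ℚ*.x∙yz≈y∙xz u v a) ⟩
  u * v + v * (u * a)              ≡⟨ cong (λ z → u * v + v * z) ua≡1 ⟩
  u * v + v * 1ℚ                   ≡⟨ cong (λ z → u * v + z) (ℚP.*-identityʳ v) ⟩
  u * v + v                        ∎
  where open ≡-Reasoning

invSqℕ+1/suc≤1/suc : ∀ n → invSqℕ (suc (suc n)) + 1/suc (suc n) ≤ 1/suc n
invSqℕ+1/suc≤1/suc n = begin
  v * v + v    ≤⟨ ℚP.+-monoˡ-≤ v (ℚP.*-monoʳ-≤-nonNeg v {{1/suc-nonNeg (suc n)}} v≤u) ⟩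
  u * v + v    ≡⟨ u≡uv+v ⟨
  u            ∎
  where
  open ℚP.≤-Reasoning
  u = 1/suc n
  v = 1/suc (suc n)
  u≡uv+v : u ≡ u * v + v
  u≡uv+v = reciprocal-difference {u} {v} (1/suc-inverse n)
             (trans (cong (v *_) (sym (toℚ-ℕ-+ 1 (suc n)))) (1/suc-inverse (suc n)))
  v≤u : v ≤ u
  v≤u = ℚP.≤-trans
    (p≤q+p v (u * v) {{ℚP.nonNeg*nonNeg⇒nonNeg u {{1/suc-nonNeg n}} v {{1/suc-nonNeg (suc n)}}}})
    (ℚP.≤-reflexive (sym u≡uv+v))

∑ : {A : Set} → List A → (A → ℚ) → ℚ
∑ xs f = sumℚ (map f xs)

when : {P : Set} → Dec P → ℚ → ℚ
when (yes _) q = q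
when (no  _) q = 0ℚ

count : {A : Set} {P : Pred A 0ℓ} → Decidable P → List A → ℕ
count P? xs = length (filter P? xs)

module _ {A : Set} where

  sumℚ-++ : ∀ (ps qs : List ℚ) → sumℚ (ps ++ qs) ≡ sumℚ ps + sumℚ qs
  sumℚ-++ []       qs = sym (ℚP.+-identityˡ (sumℚ qs))
  sumℚ-++ (p ∷ ps) qs = trans (cong (_+_ p) (sumℚ-++ ps qs)) (sym (ℚP.+-assoc p (sumℚ ps) (sumℚ qs)))

  sumℚ-concatMap : ∀ (g : A → List ℚ) xs → sumℚ (concatMap g xs) ≡ ∑ xs (sumℚ ∘ g)
  sumℚ-concatMap g []       = refl
  sumℚ-concatMap g (x ∷ xs) =
    trans (sumℚ-++ (g x) (concatMap g xs)) (cong (_+_ (sumℚ (g x))) (sumℚ-concatMap g xs))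

  ∑-cong : ∀ {f g : A → ℚ} xs → (∀ x → f x ≡ g x) → ∑ xs f ≡ ∑ xs g
  ∑-cong xs f≗g = cong sumℚ (map-cong f≗g xs)

  ∑-cong-local : ∀ {f g : A → ℚ} {xs} → All (λ x → f x ≡ g x) xs → ∑ xs f ≡ ∑ xs g
  ∑-cong-local f≗g = cong sumℚ (map-cong-local f≗g)

  ∑-mono-≤ : ∀ {f g : A → ℚ} xs → (∀ x → f x ≤ g x) → ∑ xs f ≤ ∑ xs g
  ∑-mono-≤ []       f≤g = ℚP.≤-refl
  ∑-mono-≤ (x ∷ xs) f≤g = ℚP.+-mono-≤ (f≤g x) (∑-mono-≤ xs f≤g)

  ∑-+ : ∀ (f g : A → ℚ) xs → ∑ xs (λ x → f x + g x) ≡ ∑ xs f + ∑ xs g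
  ∑-+ f g []       = refl
  ∑-+ f g (x ∷ xs) =
    trans (cong (_+_ (f x + g x)) (∑-+ f g xs)) (ℚ+.interchange (f x) (g x) (∑ xs f) (∑ xs g))

  ∑-*ˡ : ∀ q (f : A → ℚ) xs → ∑ xs (λ x → q * f x) ≡ q * ∑ xs f
  ∑-*ˡ q f []       = sym (ℚP.*-zeroʳ q)
  ∑-*ˡ q f (x ∷ xs) =
    trans (cong (_+_ (q * f x)) (∑-*ˡ q f xs)) (sym (ℚP.*-distribˡ-+ q (f x) (∑ xs f)))

  ∑-const : ∀ q (xs : List A) → ∑ xs (λ _ → q) ≡ toℚ (+ length xs) * q
  ∑-const q []       = sym (ℚP.*-zeroˡ q)
  ∑-const q (x ∷ xs) = trans (cong (_+_ q) (∑-const q xs)) (sym (toℚ-suc-* (length xs) q))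

  ∑-when : ∀ {P : Pred A 0ℓ} (P? : Decidable P) q xs → ∑ xs (λ x → when (P? x) q) ≡ toℚ (+ count P? xs) * q
  ∑-when P? q []       = sym (ℚP.*-zeroˡ q)
  ∑-when P? q (x ∷ xs) with P? x
  ... | yes _ = trans (cong (_+_ q) (∑-when P? q xs)) (sym (toℚ-suc-* (count P? xs) q))
  ... | no  _ = trans (ℚP.+-identityˡ _) (∑-when P? q xs)

  count-⊆-∪ : ∀ {P Q R : Pred A 0ℓ} (P? : Decidable P) (Q? : Decidable Q) (R? : Decidable R) →
              P ⊆ Q ∪ R → ∀ xs → count P? xs ℕ.≤ count Q? xs ℕ.+ count R? xs
  count-⊆-∪ P? Q? R? P⊆Q∪R []       = z≤n
  count-⊆-∪ P? Q? R? P⊆Q∪R (x ∷ xs) with count-⊆-∪ P? Q? R? P⊆Q∪R xs | P? x | Q? x | R? x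
  ... | ih | no  _  | no  _  | no  _  = ih
  ... | ih | no  _  | no  _  | yes _  = ℕP.≤-trans ih (ℕP.+-monoʳ-≤ _ (ℕP.n≤1+n _))
  ... | ih | no  _  | yes _  | no  _  = ℕP.m≤n⇒m≤1+n ih
  ... | ih | no  _  | yes _  | yes _  = ℕP.≤-trans ih (ℕP.+-mono-≤ (ℕP.n≤1+n _) (ℕP.n≤1+n _))
  ... | ih | yes _  | yes _  | no  _  = s≤s ih
  ... | ih | yes _  | yes _  | yes _  = s≤s (ℕP.≤-trans ih (ℕP.+-monoʳ-≤ _ (ℕP.n≤1+n _)))
  ... | ih | yes _  | no  _  | yes _  = ℕP.≤-trans (s≤s ih) (ℕP.≤-reflexive (sym (ℕP.+-suc _ _)))
  ... | ih | yes px | no ¬qx | no ¬rx = ⊥-elim ([ ¬qx , ¬rx ]′ (P⊆Q∪R px))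

  count-difference≡count-plane : ∀ (g : A → ℤ) c v xs →
    count (λ x → c ℤ.- g x ℤP.≟ v) xs ≡ count (λ x → g x ℤP.≟ c ℤ.- v) xs
  count-difference≡count-plane g c v xs = cong length (filter-≐ _ _ (to , from) xs)
    where
    involutive : ∀ c x → x ≡ c ℤ.- (c ℤ.- x)
    involutive = ℤ-Solver.solve-∀
    to : ∀ {x} → c ℤ.- g x ≡ v → g x ≡ c ℤ.- v
    to {x} c-gx≡v = trans (involutive c (g x)) (cong (λ y → c ℤ.- y) c-gx≡v)
    from : ∀ {x} → g x ≡ c ℤ.- v → c ℤ.- g x ≡ v
    from gx≡c-v = trans (cong (λ y → c ℤ.- y) gx≡c-v) (sym (involutive c v))

above : ℕ → ℕ → ℚ
above d j = when (d ℕP.<? j) (invSqℕ j)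

above-0 : ∀ j → above 0 j ≡ invSqℕ j
above-0 zero    = refl
above-0 (suc j) = refl

above-≤ : ∀ {d j} → j ℕ.≤ d → above d j ≡ 0ℚ
above-≤ {d} {j} j≤d with d ℕP.<? j
... | yes d<j = ⊥-elim (ℕP.≤⇒≯ j≤d d<j)
... | no  _   = refl

above-split : ∀ d j → above d j ≡ when (j ℕP.≟ suc d) (invSqℕ (suc d)) + above (suc d) j
above-split d j with d ℕP.<? j | j ℕP.≟ suc d | suc d ℕP.<? j
... | yes _   | yes refl | yes sd<sd = ⊥-elim (ℕP.n≮n _ sd<sd)
... | yes _   | yes refl | no  _     = sym (ℚP.+-identityʳ _)
... | yes _   | no  _    | yes _     = sym (ℚP.+-identityˡ _)
... | yes d<j | no  j≢sd | no  sd≮j  = ⊥-elim (sd≮j (ℕP.≤∧≢⇒< d<j (j≢sd ∘ sym)))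
... | no  d≮j | yes refl | _         = ⊥-elim (d≮j (ℕP.n<1+n d))
... | no  d≮j | no  _    | yes sd<j  = ⊥-elim (d≮j (ℕP.<⇒≤ sd<j))
... | no  _   | no  _    | no  _     = sym (ℚP.+-identityˡ 0ℚ)

module _ {A : Set} (h : A → ℕ) (c : ℕ) (xs : List A)
         (fibre≤ : ∀ j → count (λ x → h x ℕP.≟ suc j) xs ℕ.≤ c) where

  private
    level : ℕ → ℚ
    level d = toℚ (+ count (λ x → h x ℕP.≟ suc d) xs) * invSqℕ (suc d)

    level≤ : ∀ d → level d ≤ toℚ (+ c) * invSqℕ (suc d)
    level≤ d = ℚP.*-monoʳ-≤-nonNeg (invSqℕ (suc d)) {{invSqℕ-nonNeg (suc d)}}
                                   (toℚ-mono-≤ (ℤ.+≤+ (fibre≤ d)))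

    ∑-above-split : ∀ d → ∑ xs (above d ∘ h) ≡ level d + ∑ xs (above (suc d) ∘ h)
    ∑-above-split d = begin
      ∑ xs (above d ∘ h)                             ≡⟨ ∑-cong xs (λ x → above-split d (h x)) ⟩
      ∑ xs (λ x → at-level x + above (suc d) (h x))  ≡⟨ ∑-+ at-level (above (suc d) ∘ h) xs ⟩
      ∑ xs at-level + ∑ xs (above (suc d) ∘ h)
        ≡⟨ cong (_+ ∑ xs (above (suc d) ∘ h)) (∑-when (λ x → h x ℕP.≟ suc d) (invSqℕ (suc d)) xs) ⟩
      level d + ∑ xs (above (suc d) ∘ h)             ∎
      where
      open ≡-Reasoning
      at-level : A → ℚ
      at-level x = when (h x ℕP.≟ suc d) (invSqℕ (suc d))

    -- Induction on the slack r above level d + 1: peeling off one level keeps the tail bound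
    -- c/(d+1), since 1/(d+2)² + 1/(d+2) ≤ 1/(d+1).
    ∑-above≤ : ∀ r d → All (λ x → h x ℕ.≤ suc d ℕ.+ r) xs → ∑ xs (above (suc d) ∘ h) ≤ toℚ (+ c) * 1/suc d
    ∑-above≤ zero d bounded = begin
      ∑ xs (above (suc d) ∘ h)  ≡⟨ ∑-cong-local (All.map (above-≤ ∘ drop-+0) bounded) ⟩
      ∑ xs (λ _ → 0ℚ)           ≡⟨ trans (∑-const 0ℚ xs) (ℚP.*-zeroʳ (toℚ (+ length xs))) ⟩
      0ℚ                        ≤⟨ ℚP.nonNegative⁻¹ (toℚ (+ c) * 1/suc d) {{c/suc-nonNeg}} ⟩
      toℚ (+ c) * 1/suc d       ∎
      where
      open ℚP.≤-Reasoning
      drop-+0 : ∀ {j} → j ℕ.≤ suc d ℕ.+ 0 → j ℕ.≤ suc d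
      drop-+0 j≤ = ℕP.≤-trans j≤ (ℕP.≤-reflexive (ℕP.+-identityʳ (suc d)))
      c/suc-nonNeg : NonNegative (toℚ (+ c) * 1/suc d)
      c/suc-nonNeg = ℚP.nonNeg*nonNeg⇒nonNeg (toℚ (+ c)) {{toℚ-nonNeg c}} (1/suc d) {{1/suc-nonNeg d}}
    ∑-above≤ (suc r) d bounded = begin
      ∑ xs (above (suc d) ∘ h)
        ≡⟨ ∑-above-split (suc d) ⟩
      level (suc d) + ∑ xs (above (suc (suc d)) ∘ h)
        ≤⟨ ℚP.+-mono-≤ (level≤ (suc d)) (∑-above≤ r (suc d) bounded′) ⟩
      C * invSqℕ (suc (suc d)) + C * 1/suc (suc d)
        ≡⟨ ℚP.*-distribˡ-+ C (invSqℕ (suc (suc d))) (1/suc (suc d)) ⟨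
      C * (invSqℕ (suc (suc d)) + 1/suc (suc d))
        ≤⟨ ℚP.*-monoˡ-≤-nonNeg C {{toℚ-nonNeg c}} (invSqℕ+1/suc≤1/suc d) ⟩
      C * 1/suc d
        ∎
      where
      open ℚP.≤-Reasoning
      C = toℚ (+ c)
      bounded′ : All (λ x → h x ℕ.≤ suc (suc d) ℕ.+ r) xs
      bounded′ = All.map (λ h≤ → ℕP.≤-trans h≤ (ℕP.≤-reflexive (ℕP.+-suc (suc d) r))) bounded

  ∑-invSqℕ≤ : ∑ xs (invSqℕ ∘ h) ≤ toℚ (+ (c ℕ.+ c))
  ∑-invSqℕ≤ = begin
    ∑ xs (invSqℕ ∘ h)                    ≡⟨ ∑-cong xs (λ x → sym (above-0 (h x))) ⟩
    ∑ xs (above 0 ∘ h)                   ≡⟨ ∑-above-split 0 ⟩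
    level 0 + ∑ xs (above 1 ∘ h)         ≤⟨ ℚP.+-mono-≤ (level≤ 0) (∑-above≤ (max 0 (map h xs)) 0 bounded) ⟩
    toℚ (+ c) * 1ℚ + toℚ (+ c) * 1ℚ      ≡⟨ cong₂ _+_ (ℚP.*-identityʳ (toℚ (+ c))) (ℚP.*-identityʳ (toℚ (+ c))) ⟩
    toℚ (+ c) + toℚ (+ c)                ≡⟨ toℚ-ℕ-+ c c ⟨
    toℚ (+ (c ℕ.+ c))                    ∎
    where
    open ℚP.≤-Reasoning
    bounded : All (λ x → h x ℕ.≤ 1 ℕ.+ max 0 (map h xs)) xs
    bounded = All.map ℕP.m≤n⇒m≤1+n (map⁻ (xs≤max 0 (map h xs)))

∣i∣≡1+n⇒i≡±[1+n] : ∀ {i n} → ℤ.∣ i ∣ ≡ suc n → i ≡ + suc n ⊎ i ≡ -[1+ n ]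
∣i∣≡1+n⇒i≡±[1+n] {+ _}       refl = inj₁ refl
∣i∣≡1+n⇒i≡±[1+n] { -[1+ _ ]} refl = inj₂ refl

∑-invSq-toℚ≤ : ∀ {A : Set} (f : A → ℤ) k xs → (∀ v → count (λ x → f x ℤP.≟ v) xs ℕ.≤ k) →
               ∑ xs (λ x → invSq (toℚ (f x))) ≤ toℚ (+ ((k ℕ.+ k) ℕ.+ (k ℕ.+ k)))
∑-invSq-toℚ≤ f k xs fibre≤ = begin
  ∑ xs (λ x → invSq (toℚ (f x)))       ≡⟨ ∑-cong xs (λ x → invSq-toℚ (f x)) ⟩
  ∑ xs (λ x → invSqℕ ℤ.∣ f x ∣)         ≤⟨ ∑-invSqℕ≤ (λ x → ℤ.∣ f x ∣) (k ℕ.+ k) xs ∣f∣-fibre≤ ⟩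
  toℚ (+ ((k ℕ.+ k) ℕ.+ (k ℕ.+ k)))    ∎
  where
  open ℚP.≤-Reasoning
  ∣f∣-fibre≤ : ∀ j → count (λ x → ℤ.∣ f x ∣ ℕP.≟ suc j) xs ℕ.≤ k ℕ.+ k
  ∣f∣-fibre≤ j = ℕP.≤-trans
    (count-⊆-∪ (λ x → ℤ.∣ f x ∣ ℕP.≟ suc j) (λ x → f x ℤP.≟ + suc j) (λ x → f x ℤP.≟ -[1+ j ])
               ∣i∣≡1+n⇒i≡±[1+n] xs)
    (ℕP.+-mono-≤ (fibre≤ (+ suc j)) (fibre≤ -[1+ j ]))

toℚ³ : ℤ³ → ℚ³
toℚ³ (a₁ , a₂ , a₃) = (toℚ a₁ , toℚ a₂ , toℚ a₃)

_*³_ : ℚ³ → ℚ → ℚ³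
(p₁ , p₂ , p₃) *³ t = (p₁ * t , p₂ * t , p₃ * t)

inner-*³ : ∀ μ μ′ α t → inner μ μ′ α * t ≡ inner μ μ′ (α *³ t)
inner-*³ (x₁ , x₂ , x₃) (y₁ , y₂ , y₃) (p₁ , p₂ , p₃) t = begin
  (z₁ * p₁ + z₂ * p₂ + z₃ * p₃) * t
    ≡⟨ ℚP.*-distribʳ-+ t (z₁ * p₁ + z₂ * p₂) (z₃ * p₃) ⟩
  (z₁ * p₁ + z₂ * p₂) * t + z₃ * p₃ * t
    ≡⟨ cong (_+ z₃ * p₃ * t) (ℚP.*-distribʳ-+ t (z₁ * p₁) (z₂ * p₂)) ⟩
  z₁ * p₁ * t + z₂ * p₂ * t + z₃ * p₃ * t
    ≡⟨ cong₂ _+_ (cong₂ _+_ (ℚP.*-assoc z₁ p₁ t) (ℚP.*-assoc z₂ p₂ t)) (ℚP.*-assoc z₃ p₃ t) ⟩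
  z₁ * (p₁ * t) + z₂ * (p₂ * t) + z₃ * (p₃ * t)
    ∎
  where
  open ≡-Reasoning
  z₁ = toℚ (x₁ ℤ.- y₁)
  z₂ = toℚ (x₂ ℤ.- y₂)
  z₃ = toℚ (x₃ ℤ.- y₃)

inner-toℚ³ : ∀ μ μ′ a → inner μ μ′ (toℚ³ a) ≡ toℚ (dotℤ a μ ℤ.- dotℤ a μ′)
inner-toℚ³ μ@(x₁ , x₂ , x₃) μ′@(y₁ , y₂ , y₃) a@(a₁ , a₂ , a₃) = begin
  toℚ z₁ * toℚ a₁ + toℚ z₂ * toℚ a₂ + toℚ z₃ * toℚ a₃
    ≡⟨ cong₂ _+_ (cong₂ _+_ (toℚ-* z₁ a₁) (toℚ-* z₂ a₂)) (toℚ-* z₃ a₃) ⟨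
  toℚ (z₁ ℤ.* a₁) + toℚ (z₂ ℤ.* a₂) + toℚ (z₃ ℤ.* a₃)
    ≡⟨ cong (_+ toℚ (z₃ ℤ.* a₃)) (toℚ-+ (z₁ ℤ.* a₁) (z₂ ℤ.* a₂)) ⟨
  toℚ (z₁ ℤ.* a₁ ℤ.+ z₂ ℤ.* a₂) + toℚ (z₃ ℤ.* a₃)
    ≡⟨ toℚ-+ (z₁ ℤ.* a₁ ℤ.+ z₂ ℤ.* a₂) (z₃ ℤ.* a₃) ⟨
  toℚ (z₁ ℤ.* a₁ ℤ.+ z₂ ℤ.* a₂ ℤ.+ z₃ ℤ.* a₃)
    ≡⟨ cong toℚ (dot-difference x₁ x₂ x₃ y₁ y₂ y₃ a₁ a₂ a₃) ⟩
  toℚ (dotℤ a μ ℤ.- dotℤ a μ′)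
    ∎
  where
  open ≡-Reasoning
  z₁ = x₁ ℤ.- y₁
  z₂ = x₂ ℤ.- y₂
  z₃ = x₃ ℤ.- y₃
  dot-difference : ∀ x₁ x₂ x₃ y₁ y₂ y₃ a₁ a₂ a₃ →
    (x₁ ℤ.- y₁) ℤ.* a₁ ℤ.+ (x₂ ℤ.- y₂) ℤ.* a₂ ℤ.+ (x₃ ℤ.- y₃) ℤ.* a₃
    ≡ (a₁ ℤ.* x₁ ℤ.+ a₂ ℤ.* x₂ ℤ.+ a₃ ℤ.* x₃) ℤ.- (a₁ ℤ.* y₁ ℤ.+ a₂ ℤ.* y₂ ℤ.+ a₃ ℤ.* y₃)
  dot-difference = ℤ-Solver.solve-∀

commonDenominator : ℚ³ → ℕ
commonDenominator (p₁ , p₂ , p₃) = ↧ₙ p₁ ℕ.* ↧ₙ p₂ ℕ.* ↧ₙ p₃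

clearDenominators : ℚ³ → ℤ³
clearDenominators (p₁ , p₂ , p₃) =
  (↥ p₁ ℤ.* + (↧ₙ p₂ ℕ.* ↧ₙ p₃) , ↥ p₂ ℤ.* + (↧ₙ p₁ ℕ.* ↧ₙ p₃) , ↥ p₃ ℤ.* + (↧ₙ p₁ ℕ.* ↧ₙ p₂))

toℚ-commonDenominator≢0 : ∀ α → toℚ (+ commonDenominator α) ≢ 0ℚ
toℚ-commonDenominator≢0 α T≡0 with toℚ-injective {+ commonDenominator α} {+ 0} T≡0
... | ()

p*↧p*n≡↥p*n : ∀ p n → p * toℚ (+ (↧ₙ p ℕ.* n)) ≡ toℚ (↥ p ℤ.* + n)
p*↧p*n≡↥p*n p n = begin
  p * toℚ (+ (↧ₙ p ℕ.* n))         ≡⟨ cong (p *_) (toℚ-ℕ-* (↧ₙ p) n) ⟩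
  p * (toℚ (↧ p) * toℚ (+ n))      ≡⟨ ℚP.*-assoc p (toℚ (↧ p)) (toℚ (+ n)) ⟨
  p * toℚ (↧ p) * toℚ (+ n)        ≡⟨ cong (_* toℚ (+ n)) (p*↧p≡↥p p) ⟩
  toℚ (↥ p) * toℚ (+ n)            ≡⟨ toℚ-* (↥ p) (+ n) ⟨
  toℚ (↥ p ℤ.* + n)                ∎
  where open ≡-Reasoning

*³-commonDenominator : ∀ α → α *³ toℚ (+ commonDenominator α) ≡ toℚ³ (clearDenominators α)
*³-commonDenominator (p₁ , p₂ , p₃) =
  cong₂ _,_ (clear p₁ (ℕP.*-assoc d₁ d₂ d₃))
  (cong₂ _,_ (clear p₂ (ℕ*.xy∙z≈y∙xz d₁ d₂ d₃)) (clear p₃ (ℕP.*-comm (d₁ ℕ.* d₂) d₃)))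
  where
  d₁ = ↧ₙ p₁
  d₂ = ↧ₙ p₂
  d₃ = ↧ₙ p₃
  clear : ∀ p {n} → d₁ ℕ.* d₂ ℕ.* d₃ ≡ ↧ₙ p ℕ.* n → p * toℚ (+ (d₁ ℕ.* d₂ ℕ.* d₃)) ≡ toℚ (↥ p ℤ.* + n)
  clear p {n} T≡ = trans (cong (λ T → p * toℚ (+ T)) T≡) (p*↧p*n≡↥p*n p n)

*³≡0⇒≡0 : ∀ α {t} → t ≢ 0ℚ → α *³ t ≡ (0ℚ , 0ℚ , 0ℚ) → α ≡ (0ℚ , 0ℚ , 0ℚ)
*³≡0⇒≡0 (p₁ , p₂ , p₃) {t} t≢0 αt≡0 =
  cong₂ _,_ (cancel p₁ (cong proj₁ αt≡0))
  (cong₂ _,_ (cancel p₂ (cong (proj₁ ∘ proj₂) αt≡0)) (cancel p₃ (cong (proj₂ ∘ proj₂) αt≡0)))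
  where
  cancel : ∀ p → p * t ≡ 0ℚ → p ≡ 0ℚ
  cancel p pt≡0 = [ id , ⊥-elim ∘ t≢0 ]′ (p*q≡0⇒p≡0∨q≡0 p t pt≡0)

clearDenominators≢0 : ∀ α → α ≢ (0ℚ , 0ℚ , 0ℚ) → clearDenominators α ≢ zero³
clearDenominators≢0 α α≢0 a≡0 = α≢0 (*³≡0⇒≡0 α (toℚ-commonDenominator≢0 α)
  (trans (*³-commonDenominator α) (cong toℚ³ a≡0)))

module _ (α : ℚ³) where

  private
    T = commonDenominator α
    a = clearDenominators α

  inner-*-commonDenominator : ∀ μ μ′ → inner μ μ′ α * toℚ (+ T) ≡ toℚ (dotℤ a μ ℤ.- dotℤ a μ′)
  inner-*-commonDenominator μ μ′ = begin
    inner μ μ′ α * toℚ (+ T)       ≡⟨ inner-*³ μ μ′ α (toℚ (+ T)) ⟩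
    inner μ μ′ (α *³ toℚ (+ T))    ≡⟨ cong (inner μ μ′) (*³-commonDenominator α) ⟩
    inner μ μ′ (toℚ³ a)            ≡⟨ inner-toℚ³ μ μ′ a ⟩
    toℚ (dotℤ a μ ℤ.- dotℤ a μ′)   ∎
    where open ≡-Reasoning

  ∑-invSq-inner≤ : ∀ μ E k → (∀ d → count (λ μ′ → dotℤ a μ′ ℤP.≟ d) E ℕ.≤ k) →
                   ∑ E (λ μ′ → invSq (inner μ μ′ α)) ≤ toℚ (+ (T ℕ.* T ℕ.* 4 ℕ.* k))
  ∑-invSq-inner≤ μ E k plane≤k = begin
    ∑ E (λ μ′ → invSq (inner μ μ′ α))
      ≡⟨ ∑-cong E (λ μ′ → invSq-scale (inner μ μ′ α) (toℚ-commonDenominator≢0 α)) ⟩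
    ∑ E (λ μ′ → T² * invSq (inner μ μ′ α * Tq))
      ≡⟨ ∑-cong E (λ μ′ → cong (λ z → T² * invSq z) (inner-*-commonDenominator μ μ′)) ⟩
    ∑ E (λ μ′ → T² * invSq (toℚ (t μ′)))
      ≡⟨ ∑-*ˡ T² (λ μ′ → invSq (toℚ (t μ′))) E ⟩
    T² * ∑ E (λ μ′ → invSq (toℚ (t μ′)))
      ≤⟨ ℚP.*-monoˡ-≤-nonNeg T² {{T²-nonNeg}} (∑-invSq-toℚ≤ t k E t-fibre≤) ⟩
    T² * toℚ (+ 4k)
      ≡⟨ trans (toℚ-ℕ-* (T ℕ.* T) 4k) (cong (_* toℚ (+ 4k)) (toℚ-ℕ-* T T)) ⟨
    toℚ (+ (T ℕ.* T ℕ.* 4k))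
      ≡⟨ cong (toℚ ∘ +_) (ℕ-reorder T k) ⟩
    toℚ (+ (T ℕ.* T ℕ.* 4 ℕ.* k))
      ∎
    where
    open ℚP.≤-Reasoning
    Tq = toℚ (+ T)
    T² = Tq * Tq
    4k = (k ℕ.+ k) ℕ.+ (k ℕ.+ k)
    T²-nonNeg : NonNegative T²
    T²-nonNeg = ℚP.nonNeg*nonNeg⇒nonNeg Tq {{toℚ-nonNeg T}} Tq {{toℚ-nonNeg T}}
    t : ℤ³ → ℤ
    t μ′ = dotℤ a μ ℤ.- dotℤ a μ′
    t-fibre≤ : ∀ v → count (λ μ′ → t μ′ ℤP.≟ v) E ℕ.≤ k
    t-fibre≤ v = ℕP.≤-trans (ℕP.≤-reflexive (count-difference≡count-plane (dotℤ a) (dotℤ a μ) v E))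
                            (plane≤k (dotℤ a μ ℤ.- v))
    ℕ-reorder : ∀ T k → T ℕ.* T ℕ.* ((k ℕ.+ k) ℕ.+ (k ℕ.+ k)) ≡ T ℕ.* T ℕ.* 4 ℕ.* k
    ℕ-reorder = ℕ-Solver.solve-∀

lemma3p2 : (α : ℚ³) → α ≢ (0ℚ , 0ℚ , 0ℚ) →
    ∃[ C ] ((m : ℕ) → 0 ℕ.< m → SumOfThreeSquares m →
      (k : ℕ) → IsKappa m k →
      S α m ℚ.≤ (+ (C ℕ.* N m ℕ.* k)) ℚ./ 1)
lemma3p2 α α≢0 = C , bound
  where
  T = commonDenominator α
  C = T ℕ.* T ℕ.* 4
  bound : (m : ℕ) → 0 ℕ.< m → SumOfThreeSquares m → (k : ℕ) → IsKappa m k →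
          S α m ≤ toℚ (+ (C ℕ.* N m ℕ.* k))
  bound m _ _ k (_ , plane≤k) = begin
    S α m
      ≡⟨ sumℚ-concatMap (λ μ → map (λ μ′ → invSq (inner μ μ′ α)) E) E ⟩
    ∑ E (λ μ → ∑ E (λ μ′ → invSq (inner μ μ′ α)))
      ≤⟨ ∑-mono-≤ E (λ μ → ∑-invSq-inner≤ α μ E k (λ d → plane≤k _ d (clearDenominators≢0 α α≢0))) ⟩
    ∑ E (λ _ → toℚ (+ (C ℕ.* k)))
      ≡⟨ trans (∑-const (toℚ (+ (C ℕ.* k))) E) (sym (toℚ-ℕ-* (N m) (C ℕ.* k))) ⟩
    toℚ (+ (N m ℕ.* (C ℕ.* k)))
      ≡⟨ cong (toℚ ∘ +_) (ℕ-reorder (N m) C k) ⟩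
    toℚ (+ (C ℕ.* N m ℕ.* k))
      ∎
    where
    open ℚP.≤-Reasoning
    E = 𝓔 m
    ℕ-reorder : ∀ n C k → n ℕ.* (C ℕ.* k) ≡ C ℕ.* n ℕ.* k
    ℕ-reorder = ℕ-Solver.solve-∀
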